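{- The common independence oracle (CI) is not polynomially reducible to the maximum rank oracle (Max), but it is polynomially reducible to the minimum rank oracle (Min) and to the rank sum oracle (Sum).
   Context: Let $\mathbf{M}_1=(E,\mathcal{I}_1)$, $\mathbf{M}_2=(E,\mathcal{I}_2)$ be loopless matroids on a common finite ground set $E$ with rank functions $r_1,r_2$. For a queried $X\subseteq E$: Sum returns $r_1(X)+r_2(X)$; Min returns $\min\{r_1(X),r_2(X)\}$; Max returns $\max\{r_1(X),r_2(X)\}$; CI returns ``Yes'' if $X\in\mathcal{I}_1\cap\mathcal{I}_2$ and ``No'' otherwise. An oracle $\mathcal{O}_1$ is polynomially reducible to an oracle $\mathcal{O}_2$ if, for every such pair of matroids, the answer of $\mathcal{O}_1$ to any query can be computed using a number of calls to $\mathcal{O}_2$ bounded by a polynomial in $|E|$ (in particular, the answers of $\mathcal{O}_2$ must determine those of $\mathcal{O}_1$). -}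

module Defs where

open import Data.Nat using (ℕ; zero; suc; _+_; _*_; _^_; _≤_; _<_; _⊔_; _⊓_)
open import Data.Bool using (Bool; true; false; _∧_; if_then_else_)
open import Data.Vec using (Vec; []; _∷_)
open import Data.List using (List; [_]; _++_; map; foldr)
open import Data.Fin using (Fin)
open import Data.Fin.Subset using (Subset; ⊥; ⁅_⁆; _∈_; _∉_; _⊆_; _∪_; ∣_∣)
open import Data.Fin.Subset.Properties using (_⊆?_)
open import Data.Product using (Σ; ∃; _×_; _,_)
open import Relation.Nullary using (does)
open import Relation.Binary.PropositionalEquality using (_≡_)

record Matroid (n : ℕ) : Set where
  field
    indep     : Subset n → Bool
    indep-⊥   : indep ⊥ ≡ true
    indep-⊆   : ∀ {X Y} → X ⊆ Y → indep Y ≡ true → indep X ≡ true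
    indep-exch : ∀ {X Y} → indep X ≡ true → indep Y ≡ true → ∣ X ∣ < ∣ Y ∣ →
                 ∃ λ e → e ∈ Y × e ∉ X × indep (X ∪ ⁅ e ⁆) ≡ true

open Matroid public

Loopless : ∀ {n} → Matroid n → Set
Loopless {n} M = (e : Fin n) → indep M ⁅ e ⁆ ≡ true

subsets : (n : ℕ) → List (Subset n)
subsets zero    = [ [] ]
subsets (suc n) = map (true ∷_) (subsets n) ++ map (false ∷_) (subsets n)

rank : ∀ {n} → Matroid n → Subset n → ℕ
rank {n} M X =
  foldr _⊔_ 0 (map (λ I → if does (I ⊆? X) ∧ indep M I then ∣ I ∣ else 0) (subsets n))

Oracle : Set → Set
Oracle A = ∀ {n} → Matroid n → Matroid n → Subset n → A

Sum Min Max : Oracle ℕ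
Sum M₁ M₂ X = rank M₁ X + rank M₂ X
Min M₁ M₂ X = rank M₁ X ⊓ rank M₂ X
Max M₁ M₂ X = rank M₁ X ⊔ rank M₂ X

CI : Oracle Bool
CI M₁ M₂ X = indep M₁ X ∧ indep M₂ X

-- Adaptive oracle algorithms (decision trees): queries subsets of Fin n,
-- receives answers in A, finally outputs a value in B.

data Alg (n : ℕ) (A B : Set) : Set where
  done  : B → Alg n A B
  query : Subset n → (A → Alg n A B) → Alg n A B

run : ∀ {n A B} → Alg n A B → (Subset n → A) → B
run (done b)    f = b
run (query X k) f = run (k (f X)) f

calls : ∀ {n A B} → Alg n A B → (Subset n → A) → ℕ
calls (done b)    f = 0
calls (query X k) f = suc (calls (k (f X)) f)

PolyReducible : ∀ {A B} → Oracle A → Oracle B → Set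
PolyReducible {A} {B} O₁ O₂ =
  Σ ℕ λ c → Σ ℕ λ d →
    ∀ n (X : Subset n) → Σ (Alg n B A) λ T →
      ∀ (M₁ M₂ : Matroid n) → Loopless M₁ → Loopless M₂ →
        run T (O₂ M₁ M₂) ≡ O₁ M₁ M₂ X × calls T (O₂ M₁ M₂) ≤ c * (n + 1) ^ d

-- Since r(X) ≤ |X| with equality exactly when X is independent, X is
-- commonly independent iff min(r₁ X, r₂ X) = |X|, iff r₁ X + r₂ X = 2|X|:
-- one Min or Sum query decides CI. Max cannot: if M₁ is free then
-- max(r₁ X, r₂ X) = |X| whatever M₂ is, so the free matroid paired with
-- itself and with U₁,₂ give the same Max answers but differ on CI(E).
module Submission where

open import Defs
open import Data.Product using (_×_)
open import Relation.Nullary using (¬_)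

open import Data.Bool using (true; false; _∧_; if_then_else_)
open import Data.Bool.Properties using (T-≡)
open import Data.Fin.Properties using (any?)
open import Data.Fin.Subset using (Subset; ⊥; ⊤; ⁅_⁆; _∈_; _∉_; _⊆_; _∪_; ∣_∣; inside; outside)
open import Data.Fin.Subset.Properties
  using (_∈?_; _⊆?_; ⊆-refl; ⊥⊆; ∣⊥∣≡0; ∣⁅x⁆∣≡1; ∣p∣≤n; p⊆q⇒∣p∣≤∣q∣; p⊂q⇒∣p∣<∣q∣)
open import Data.List using (map)
import Data.List.Membership.Propositional as List
open import Data.List.Membership.Propositional.Properties using (∈-map⁺; ∈-map⁻; ∈-++⁺ˡ; ∈-++⁺ʳ; foldr-selective)
open import Data.List.Properties using (foldr-preservesᵇ; foldr-preservesᵒ)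
open import Data.List.Relation.Unary.All using (universal)
open import Data.List.Relation.Unary.All.Properties using (map⁺)
import Data.List.Relation.Unary.Any as Any
open import Data.Nat using (ℕ; suc; _+_; _≤_; _<_; _⊔_; _⊓_; z≤n; s≤s; _≟_; _≤?_)
open import Data.Nat.Properties
open import Data.Product using (∃; _,_; proj₁)
open import Data.Sum using (inj₁; inj₂; [_,_])
open import Data.Vec using ([]; _∷_)
open import Function using (_∘_)
open import Function.Bundles using (_⇔_; mk⇔; Equivalence)
open import Function.Properties.Equivalence using () renaming (trans to ⇔-trans)
open import Relation.Nullary using (Dec; does; yes; no; ¬?; contradiction)
open import Relation.Nullary.Decidable using (dec-true; does-⇔; T?; _×-dec_)
open import Relation.Binary.PropositionalEquality using (_≡_; _≗_; refl; sym; trans; cong; cong₂; module ≡-Reasoning)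

variable
  n : ℕ

∣p∣<∣q∣⇒∃[x∈q∖p] : {p q : Subset n} → ∣ p ∣ < ∣ q ∣ → ∃ λ x → x ∈ q × x ∉ p
∣p∣<∣q∣⇒∃[x∈q∖p] {p = p} {q} ∣p∣<∣q∣ with any? (λ x → (x ∈? q) ×-dec (¬? (x ∈? p)))
... | yes x∈q∖p = x∈q∖p
... | no ∄x = contradiction (p⊆q⇒∣p∣≤∣q∣ q⊆p) (<⇒≱ ∣p∣<∣q∣)
  where
  q⊆p : q ⊆ p
  q⊆p {x} x∈q with x ∈? p
  ... | yes x∈p = x∈p
  ... | no x∉p = contradiction (x , x∈q , x∉p) ∄x

p⊆q⇒∣q∣≤∣p∣⇒q⊆p : {p q : Subset n} → p ⊆ q → ∣ q ∣ ≤ ∣ p ∣ → q ⊆ p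
p⊆q⇒∣q∣≤∣p∣⇒q⊆p {p = p} p⊆q ∣q∣≤∣p∣ {x} x∈q with x ∈? p
... | yes x∈p = x∈p
... | no x∉p = contradiction (p⊂q⇒∣p∣<∣q∣ (p⊆q , x , x∈q , x∉p)) (≤⇒≯ ∣q∣≤∣p∣)

∣p∪q∣≤∣p∣+∣q∣ : (p q : Subset n) → ∣ p ∪ q ∣ ≤ ∣ p ∣ + ∣ q ∣
∣p∪q∣≤∣p∣+∣q∣ []            []            = z≤n
∣p∪q∣≤∣p∣+∣q∣ (outside ∷ p) (outside ∷ q) = ∣p∪q∣≤∣p∣+∣q∣ p q
∣p∪q∣≤∣p∣+∣q∣ (outside ∷ p) (inside ∷ q)  =
  ≤-trans (s≤s (∣p∪q∣≤∣p∣+∣q∣ p q)) (≤-reflexive (sym (+-suc ∣ p ∣ ∣ q ∣)))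
∣p∪q∣≤∣p∣+∣q∣ (inside ∷ p)  (outside ∷ q) = s≤s (∣p∪q∣≤∣p∣+∣q∣ p q)
∣p∪q∣≤∣p∣+∣q∣ (inside ∷ p)  (inside ∷ q)  =
  s≤s (≤-trans (∣p∪q∣≤∣p∣+∣q∣ p q) (+-monoʳ-≤ ∣ p ∣ (n≤1+n ∣ q ∣)))

∈-subsets : (X : Subset n) → X List.∈ subsets n
∈-subsets []          = Any.here refl
∈-subsets (true ∷ X)  = ∈-++⁺ˡ (∈-map⁺ (true ∷_) (∈-subsets X))
∈-subsets (false ∷ X) = ∈-++⁺ʳ _ (∈-map⁺ (false ∷_) (∈-subsets X))

module _ (M : Matroid n) where

  indep-of-∣∣≡0 : {X : Subset n} → ∣ X ∣ ≡ 0 → indep M X ≡ true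
  indep-of-∣∣≡0 ∣X∣≡0 =
    indep-⊆ M (p⊆q⇒∣q∣≤∣p∣⇒q⊆p ⊥⊆ (≤-trans (≤-reflexive ∣X∣≡0) z≤n)) (indep-⊥ M)

  module _ (X : Subset n) where

    rankTerm : Subset n → ℕ
    rankTerm I = if does (I ⊆? X) ∧ indep M I then ∣ I ∣ else 0

    rankTerm≤∣X∣ : (I : Subset n) → rankTerm I ≤ ∣ X ∣
    rankTerm≤∣X∣ I with I ⊆? X | indep M I
    ... | yes I⊆X | true  = p⊆q⇒∣p∣≤∣q∣ I⊆X
    ... | yes _   | false = z≤n
    ... | no _    | _     = z≤n

    rankTerm≡∣X∣⇒indep : (I : Subset n) → rankTerm I ≡ ∣ X ∣ → indep M X ≡ true
    rankTerm≡∣X∣⇒indep I eq with I ⊆? X | indep M I in indep-I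
    ... | yes I⊆X | true  = indep-⊆ M (p⊆q⇒∣q∣≤∣p∣⇒q⊆p I⊆X (≤-reflexive (sym eq))) indep-I
    ... | yes _   | false = indep-of-∣∣≡0 (sym eq)
    ... | no _    | _     = indep-of-∣∣≡0 (sym eq)

    rank≤∣∣ : rank M X ≤ ∣ X ∣
    rank≤∣∣ = foldr-preservesᵇ {P = _≤ ∣ X ∣} ⊔-lub z≤n (map⁺ (universal rankTerm≤∣X∣ (subsets n)))

    rankTerm≤rank : (I : Subset n) → rankTerm I ≤ rank M X
    rankTerm≤rank I = foldr-preservesᵒ
      (λ a b → [ (λ k≤a → m≤n⇒m≤n⊔o b k≤a) , (λ k≤b → m≤n⇒m≤o⊔n a k≤b) ]) 0 _
      (inj₂ (Any.map ≤-reflexive (∈-map⁺ rankTerm (∈-subsets I))))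

    indep⇔rank≡∣∣ : indep M X ≡ true ⇔ rank M X ≡ ∣ X ∣
    indep⇔rank≡∣∣ = mk⇔ indep⇒ ⇒indep
      where
      indep⇒ : indep M X ≡ true → rank M X ≡ ∣ X ∣
      indep⇒ indep-X = ≤-antisym rank≤∣∣ (≤-trans (≤-reflexive (sym rankTerm[X])) (rankTerm≤rank X))
        where
        rankTerm[X] : rankTerm X ≡ ∣ X ∣
        rankTerm[X] rewrite dec-true (X ⊆? X) ⊆-refl | indep-X = refl

      ⇒indep : rank M X ≡ ∣ X ∣ → indep M X ≡ true
      ⇒indep eq with foldr-selective ⊔-sel 0 (map rankTerm (subsets n))
      ... | inj₁ rank≡0 = indep-of-∣∣≡0 (trans (sym eq) rank≡0)
      ... | inj₂ rank∈ with ∈-map⁻ rankTerm rank∈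
      ...   | I , _ , rank≡rankTerm = rankTerm≡∣X∣⇒indep I (trans (sym rank≡rankTerm) eq)

    indep≡does[rank≟∣∣] : indep M X ≡ does (rank M X ≟ ∣ X ∣)
    indep≡does[rank≟∣∣] = does-⇔ (⇔-trans T-≡ indep⇔rank≡∣∣) (T? (indep M X)) (rank M X ≟ ∣ X ∣)

does≡CI : {P : Set} (M₁ M₂ : Matroid n) (X : Subset n) →
  (P ⇔ (rank M₁ X ≡ ∣ X ∣ × rank M₂ X ≡ ∣ X ∣)) → (P? : Dec P) → does P? ≡ CI M₁ M₂ X
does≡CI M₁ M₂ X P⇔ P? = trans
  (does-⇔ P⇔ P? ((rank M₁ X ≟ ∣ X ∣) ×-dec (rank M₂ X ≟ ∣ X ∣)))
  (sym (cong₂ _∧_ (indep≡does[rank≟∣∣] M₁ X) (indep≡does[rank≟∣∣] M₂ X)))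

m⊓n≡o⇔m≡o×n≡o : {m n o : ℕ} → m ≤ o → n ≤ o → (m ⊓ n ≡ o ⇔ (m ≡ o × n ≡ o))
m⊓n≡o⇔m≡o×n≡o {m} {n} {o} m≤o n≤o = mk⇔
  (λ eq → ≤-antisym m≤o (≤-trans (≤-reflexive (sym eq)) (m⊓n≤m m n))
        , ≤-antisym n≤o (≤-trans (≤-reflexive (sym eq)) (m⊓n≤n m n)))
  (λ { (refl , refl) → ⊓-idem o })

m+n≡o+o⇔m≡o×n≡o : {m n o : ℕ} → m ≤ o → n ≤ o → (m + n ≡ o + o ⇔ (m ≡ o × n ≡ o))
m+n≡o+o⇔m≡o×n≡o {m} {n} {o} m≤o n≤o = mk⇔
  (λ eq → ≤-antisym m≤o (+-cancelʳ-≤ o o m (≤-trans (≤-reflexive (sym eq)) (+-monoʳ-≤ m n≤o)))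
        , ≤-antisym n≤o (+-cancelˡ-≤ o o n (≤-trans (≤-reflexive (sym eq)) (+-monoˡ-≤ n m≤o))))
  (λ { (refl , refl) → refl })

reducible-by-one-query : ∀ {A B} {O₁ : Oracle A} {O₂ : Oracle B} →
  (decode : ∀ {n} → Subset n → B → A) →
  (∀ {n} (M₁ M₂ : Matroid n) X → decode X (O₂ M₁ M₂ X) ≡ O₁ M₁ M₂ X) →
  PolyReducible O₁ O₂
reducible-by-one-query decode correct =
  1 , 0 , λ n X → query X (done ∘ decode X) , λ M₁ M₂ _ _ → correct M₁ M₂ X , s≤s z≤n

CI-reducible-to-Min : PolyReducible CI Min
CI-reducible-to-Min = reducible-by-one-query (λ X m → does (m ≟ ∣ X ∣)) λ M₁ M₂ X →
  does≡CI M₁ M₂ X (m⊓n≡o⇔m≡o×n≡o (rank≤∣∣ M₁ X) (rank≤∣∣ M₂ X)) (Min M₁ M₂ X ≟ ∣ X ∣)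

CI-reducible-to-Sum : PolyReducible CI Sum
CI-reducible-to-Sum = reducible-by-one-query (λ X m → does (m ≟ ∣ X ∣ + ∣ X ∣)) λ M₁ M₂ X →
  does≡CI M₁ M₂ X (m+n≡o+o⇔m≡o×n≡o (rank≤∣∣ M₁ X) (rank≤∣∣ M₂ X)) (Sum M₁ M₂ X ≟ ∣ X ∣ + ∣ X ∣)

uniform : (k n : ℕ) → Matroid n
uniform k n = record
  { indep      = λ X → does (∣ X ∣ ≤? k)
  ; indep-⊥    = dec-true (∣ ⊥ {n = n} ∣ ≤? k) (≤-trans (≤-reflexive (∣⊥∣≡0 n)) z≤n)
  ; indep-⊆    = λ {X} X⊆Y ∣Y∣≤k → dec-true (∣ X ∣ ≤? k) (≤-trans (p⊆q⇒∣p∣≤∣q∣ X⊆Y) (≤-of-does ∣Y∣≤k))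
  ; indep-exch = exchange
  }
  where
  ≤-of-does : {m : ℕ} → does (m ≤? k) ≡ true → m ≤ k
  ≤-of-does {m} = ≤ᵇ⇒≤ m k ∘ Equivalence.from T-≡

  exchange : {X Y : Subset n} → does (∣ X ∣ ≤? k) ≡ true → does (∣ Y ∣ ≤? k) ≡ true → ∣ X ∣ < ∣ Y ∣ →
             ∃ λ e → e ∈ Y × e ∉ X × does (∣ X ∪ ⁅ e ⁆ ∣ ≤? k) ≡ true
  exchange {X} {Y} _ ∣Y∣≤k ∣X∣<∣Y∣ with ∣p∣<∣q∣⇒∃[x∈q∖p] ∣X∣<∣Y∣
  ... | e , e∈Y , e∉X = e , e∈Y , e∉X , dec-true (∣ X ∪ ⁅ e ⁆ ∣ ≤? k) (begin
    ∣ X ∪ ⁅ e ⁆ ∣       ≤⟨ ∣p∪q∣≤∣p∣+∣q∣ X ⁅ e ⁆ ⟩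
    ∣ X ∣ + ∣ ⁅ e ⁆ ∣   ≡⟨ cong (∣ X ∣ +_) (∣⁅x⁆∣≡1 e) ⟩
    ∣ X ∣ + 1           ≡⟨ +-comm ∣ X ∣ 1 ⟩
    suc ∣ X ∣           ≤⟨ ∣X∣<∣Y∣ ⟩
    ∣ Y ∣               ≤⟨ ≤-of-does ∣Y∣≤k ⟩
    k                   ∎)
    where open ≤-Reasoning

uniform-loopless : {k : ℕ} → 1 ≤ k → Loopless (uniform k n)
uniform-loopless {k = k} 1≤k e = dec-true (∣ ⁅ e ⁆ ∣ ≤? k) (≤-trans (≤-reflexive (∣⁅x⁆∣≡1 e)) 1≤k)

free : (n : ℕ) → Matroid n
free n = uniform n n

free-indep : (X : Subset n) → indep (free n) X ≡ true
free-indep {n} X = dec-true (∣ X ∣ ≤? n) (∣p∣≤n X)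

Max-free : (M : Matroid n) (X : Subset n) → Max (free n) M X ≡ ∣ X ∣
Max-free {n} M X = begin
  rank (free n) X ⊔ rank M X  ≡⟨ cong (_⊔ rank M X) rank-free ⟩
  ∣ X ∣ ⊔ rank M X            ≡⟨ m≥n⇒m⊔n≡m (rank≤∣∣ M X) ⟩
  ∣ X ∣                       ∎
  where
  open ≡-Reasoning
  rank-free : rank (free n) X ≡ ∣ X ∣
  rank-free = Equivalence.to (indep⇔rank≡∣∣ (free n) X) (free-indep X)

run-cong : ∀ {A B} (T : Alg n A B) {f g : Subset n → A} → f ≗ g → run T f ≡ run T g
run-cong (done b)    f≗g = refl
run-cong (query X k) {g = g} f≗g rewrite f≗g X = run-cong (k (g X)) f≗g

¬PolyReducible-of-indistinguishable : ∀ {A B} {O₁ : Oracle A} {O₂ : Oracle B} n (X : Subset n) →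
  (M₁ M₂ M₁′ M₂′ : Matroid n) → Loopless M₁ → Loopless M₂ → Loopless M₁′ → Loopless M₂′ →
  O₂ M₁ M₂ ≗ O₂ M₁′ M₂′ → ¬ O₁ M₁ M₂ X ≡ O₁ M₁′ M₂′ X → ¬ PolyReducible O₁ O₂
¬PolyReducible-of-indistinguishable {O₁ = O₁} {O₂} n X M₁ M₂ M₁′ M₂′ ℓ₁ ℓ₂ ℓ₁′ ℓ₂′ same differ
  (_ , _ , reduce) with reduce n X
... | T , correct = differ (begin
  O₁ M₁ M₂ X             ≡⟨ sym (proj₁ (correct M₁ M₂ ℓ₁ ℓ₂)) ⟩
  run T (O₂ M₁ M₂)       ≡⟨ run-cong T same ⟩
  run T (O₂ M₁′ M₂′)     ≡⟨ proj₁ (correct M₁′ M₂′ ℓ₁′ ℓ₂′) ⟩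
  O₁ M₁′ M₂′ X           ∎)
  where open ≡-Reasoning

CI-not-reducible-to-Max : ¬ PolyReducible CI Max
CI-not-reducible-to-Max =
  ¬PolyReducible-of-indistinguishable 2 ⊤ (free 2) (free 2) (free 2) (uniform 1 2)
    loopless loopless loopless (uniform-loopless (s≤s z≤n))
    (λ X → trans (Max-free (free 2) X) (sym (Max-free (uniform 1 2) X)))
    (λ ())
  where
  loopless : Loopless (free 2)
  loopless = uniform-loopless (s≤s z≤n)

theorem3p1 : (¬ PolyReducible CI Max) × PolyReducible CI Min × PolyReducible CI Sum
theorem3p1 = CI-not-reducible-to-Max , CI-reducible-to-Min , CI-reducible-to-Sum
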